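{- Let $\mathcal{S}$ be a single-set cubical $\omega$-category with connections, and let $i,j\in\mathbb{N}_+$, $\alpha\in\{ -,+\}$ (with $-\alpha$ the opposite sign). (i) If $x\in\mathcal{S}^j$, then $\delta_j^\alpha\gamma_j^{ -\alpha}x=\delta_{j+1}^\alpha x$ and $\delta_{j+1}^\alpha\gamma_j^{ -\alpha}x=\delta_{j+1}^\alpha x$. (ii) If $x,y\in\mathcal{S}^i$ and $\Delta_{i+1}(x,y)$, then $\gamma_i^+(x\circ_{i+1}y)=(\gamma_i^+x\circ_ix)\circ_{i+1}(s_ix\circ_i\gamma_i^+y)$ and $\gamma_i^-(x\circ_{i+1}y)=(\gamma_i^-x\circ_is_iy)\circ_{i+1}(y\circ_i\gamma_i^-y)$. (iii) If $|i-j|\geq2$, $x\in\mathcal{S}^{i,j}$ and $y\in\mathcal{S}^{i,j+1}$, then $\gamma_i^\alpha s_jx=s_j\gamma_i^\alpha x$ and $\gamma_i^\alpha\tilde s_jy=\tilde s_j\gamma_i^\alpha y$. (iv) If $x\in\mathcal{S}^{i,i+2}$, then $\tilde s_i\tilde s_{i+1}\gamma_i^\alpha x=\gamma_{i+1}^\alpha\tilde s_{i+1}x$.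
   Context: A single-set category is a set $\mathcal{S}$ with $\delta^-,\delta^+:\mathcal{S}\to\mathcal{S}$ and $\odot:\mathcal{S}\times\mathcal{S}\to\mathcal{P}(\mathcal{S})$ (extended to subsets by unions) with $\{x\}\odot(y\odot z)=(x\odot y)\odot\{z\}$, $x\odot\delta^+x=\{x\}=\delta^-x\odot x$, $x\odot y\neq\varnothing\iff\delta^+x=\delta^-y$, and $|x\odot y|\leq1$; $\Delta(x,y)$ means $x\odot y\neq\varnothing$ and $x\circ y$ is its element. A single-set cubical $\omega$-category with connections is a set $\mathcal{S}$ with, for each $i\in\mathbb{N}_+$, a single-set category structure $(\delta_i^\pm,\odot_i)$ (with $\Delta_i,\circ_i$) and maps $s_i,\tilde s_i,\gamma_i^-,\gamma_i^+:\mathcal{S}\to\mathcal{S}$; with $\mathcal{S}^i$ the fixed points of $\delta_i^-$ (equivalently $\delta_i^+$) and $\mathcal{S}^{i,j}=\mathcal{S}^i\cap\mathcal{S}^j$, the axioms (all $i,j$, $\alpha,\beta\in\{ -,+\}$) are: $\delta_i^\alpha\delta_j^\beta=\delta_j^\beta\delta_i^\alpha$ ($i\neq j$); $\delta_i^\alpha(x\circ_jy)=\delta_i^\alpha x\circ_j\delta_i^\alpha y$ ($i\neq j$, $\Delta_j(x,y)$); $(w\circ_ix)\circ_j(y\circ_iz)=(w\circ_jy)\circ_i(x\circ_jz)$ ($i\neq j$, $\Delta_i(w,x),\Delta_i(y,z),\Delta_j(w,y),\Delta_j(x,z)$); $s_i(\mathcal{S}^i)\subseteq\mathcal{S}^{i+1}$,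 $\tilde s_i(\mathcal{S}^{i+1})\subseteq\mathcal{S}^i$; $\tilde s_is_ix=x$ ($x\in\mathcal{S}^i$), $s_i\tilde s_iy=y$ ($y\in\mathcal{S}^{i+1}$); for $x\in\mathcal{S}^j$: $\delta_j^\alpha s_jx=s_j\delta_{j+1}^\alpha x$, $\delta_i^\alpha s_jx=s_j\delta_i^\alpha x$ ($i\neq j,j+1$); for $x,y\in\mathcal{S}^i$: $s_i(x\circ_{i+1}y)=s_ix\circ_is_iy$ ($\Delta_{i+1}(x,y)$), $s_i(x\circ_jy)=s_ix\circ_js_iy$ ($j\neq i,i+1$, $\Delta_j(x,y)$); $s_ix=x$ on $\mathcal{S}^{i,i+1}$; $s_is_jx=s_js_ix$ ($|i-j|\geq2$, $x\in\mathcal{S}^{i,j}$); every $x$ lies in $\mathcal{S}^i$ for all large $i$; for $x\in\mathcal{S}^j$: $\delta_j^\alpha\gamma_j^\alpha x=x$, $\delta_{j+1}^\alpha\gamma_j^\alpha x=s_jx$, $\delta_i^\alpha\gamma_j^\beta x=\gamma_j^\beta\delta_i^\alpha x$ ($i\neq j,j+1$); for $x,y\in\mathcal{S}^i$ with $\Delta_{i+1}(x,y)$: $\gamma_i^+(x\circ_{i+1}y)=(\gamma_i^+x\circ_{i+1}s_ix)\circ_i(x\circ_{i+1}\gamma_i^+y)$, $\gamma_i^-(x\circ_{i+1}y)=(\gamma_i^-x\circ_{i+1}y)\circ_i(s_iy\circ_{i+1}\gamma_i^-y)$; $\gamma_i^\alpha(x\circ_jy)=\gamma_i^\alpha x\circ_j\gamma_i^\alpha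 y$ ($x,y\in\mathcal{S}^i$, $j\neq i,i+1$, $\Delta_j(x,y)$); $\gamma_i^\alpha x=x$ on $\mathcal{S}^{i,i+1}$; $\gamma_i^+x\circ_{i+1}\gamma_i^-x=x$ and $\gamma_i^+x\circ_i\gamma_i^-x=s_ix$ ($x\in\mathcal{S}^i$); $\gamma_i^\alpha\gamma_j^\beta x=\gamma_j^\beta\gamma_i^\alpha x$ ($|i-j|\geq2$, $x\in\mathcal{S}^{i,j}$); $s_{i+1}s_i\gamma_{i+1}^\alpha x=\gamma_i^\alpha s_{i+1}x$ ($x\in\mathcal{S}^{i,i+1}$). -}

module Defs where

open import Data.Nat using (ℕ; suc; _≤_; ∣_-_∣)
open import Data.Product using (Σ; Σ-syntax; _×_)
open import Relation.Binary.PropositionalEquality using (_≡_; _≢_)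
open import Function.Bundles using (_⇔_)

data Sign : Set where
  ⁻ ⁺ : Sign

opp : Sign → Sign
opp ⁻ = ⁺
opp ⁺ = ⁻

-- A single-set category on S.  The partial composition
-- ⊙ : S × S → P(S) is given as a membership relation:
-- Comp x y w  means  w ∈ x ⊙ y.
record IsSingleSetCategory {S : Set} (δ⁻ δ⁺ : S → S)
                           (Comp : S → S → S → Set) : Set where
  field
    assoc : ∀ x y z w →
      (Σ[ u ∈ S ] (Comp y z u × Comp x u w)) ⇔ (Σ[ v ∈ S ] (Comp x y v × Comp v z w))
    unitʳ : ∀ x w → Comp x (δ⁺ x) w ⇔ (w ≡ x)
    unitˡ : ∀ x w → Comp (δ⁻ x) x w ⇔ (w ≡ x)
    defined : ∀ x y → (Σ[ w ∈ S ] Comp x y w) ⇔ (δ⁺ x ≡ δ⁻ y)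
    functional : ∀ x y u v → Comp x y u → Comp x y v → u ≡ v

-- INDEXING CONVENTION: an index i : ℕ stands for the positive index i+1
-- of the paper (so index 0 here is the paper's 1).  All axioms only
-- involve differences of indices and successors, so this shift is harmless.
-- An equation "f (x ∘_j y) = E" (E built from composites) is encoded as:
-- for every z ∈ x ⊙_j y, the composites in E exist and f z is their value.
record CubicalωCat : Set₁ where
  field
    S    : Set
    δ    : Sign → ℕ → S → S
    Comp : ℕ → S → S → S → Set
    isCat : ∀ i → IsSingleSetCategory (δ ⁻ i) (δ ⁺ i) (Comp i)
    s s̃  : ℕ → S → S
    γ    : Sign → ℕ → S → S

  Cell : ℕ → S → Set
  Cell i x = δ ⁻ i x ≡ x

  field
    δ-comm : ∀ i j α β → i ≢ j → ∀ x → δ α i (δ β j x) ≡ δ β j (δ α i x)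
    δ-comp : ∀ i j α → i ≢ j → ∀ x y z → Comp j x y z →
      Comp j (δ α i x) (δ α i y) (δ α i z)
    interchange : ∀ i j → i ≢ j → ∀ w x y z a b c d →
      Comp i w x a → Comp i y z b → Comp j w y c → Comp j x z d →
      Σ[ e ∈ S ] (Comp j a b e × Comp i c d e)
    s-cell : ∀ i x → Cell i x → Cell (suc i) (s i x)
    s̃-cell : ∀ i y → Cell (suc i) y → Cell i (s̃ i y)
    s̃s : ∀ i x → Cell i x → s̃ i (s i x) ≡ x
    ss̃ : ∀ i y → Cell (suc i) y → s i (s̃ i y) ≡ y
    δ-s-same : ∀ j α x → Cell j x → δ α j (s j x) ≡ s j (δ α (suc j) x)
    δ-s-other : ∀ i j α x → i ≢ j → i ≢ suc j → Cell j x →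
      δ α i (s j x) ≡ s j (δ α i x)
    s-comp-next : ∀ i x y z → Cell i x → Cell i y → Comp (suc i) x y z →
      Comp i (s i x) (s i y) (s i z)
    s-comp-other : ∀ i j x y z → j ≢ i → j ≢ suc i → Cell i x → Cell i y →
      Comp j x y z → Comp j (s i x) (s i y) (s i z)
    s-id : ∀ i x → Cell i x → Cell (suc i) x → s i x ≡ x
    s-comm : ∀ i j x → 2 ≤ ∣ i - j ∣ → Cell i x → Cell j x →
      s i (s j x) ≡ s j (s i x)
    finite-dim : ∀ x → Σ[ n ∈ ℕ ] (∀ i → n ≤ i → Cell i x)
    γ-δ-same : ∀ j α x → Cell j x → δ α j (γ α j x) ≡ x
    γ-δ-next : ∀ j α x → Cell j x → δ α (suc j) (γ α j x) ≡ s j x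
    γ-δ-other : ∀ i j α β x → i ≢ j → i ≢ suc j → Cell j x →
      δ α i (γ β j x) ≡ γ β j (δ α i x)
    γ⁺-comp : ∀ i x y z → Cell i x → Cell i y → Comp (suc i) x y z →
      Σ[ a ∈ S ] Σ[ b ∈ S ]
        (Comp (suc i) (γ ⁺ i x) (s i x) a × Comp (suc i) x (γ ⁺ i y) b
         × Comp i a b (γ ⁺ i z))
    γ⁻-comp : ∀ i x y z → Cell i x → Cell i y → Comp (suc i) x y z →
      Σ[ a ∈ S ] Σ[ b ∈ S ]
        (Comp (suc i) (γ ⁻ i x) y a × Comp (suc i) (s i y) (γ ⁻ i y) b
         × Comp i a b (γ ⁻ i z))
    γ-comp-other : ∀ i j α x y z → j ≢ i → j ≢ suc i → Cell i x → Cell i y →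
      Comp j x y z → Comp j (γ α i x) (γ α i y) (γ α i z)
    γ-id : ∀ i α x → Cell i x → Cell (suc i) x → γ α i x ≡ x
    γ-inv₁ : ∀ i x → Cell i x → Comp (suc i) (γ ⁺ i x) (γ ⁻ i x) x
    γ-inv₂ : ∀ i x → Cell i x → Comp i (γ ⁺ i x) (γ ⁻ i x) (s i x)
    γ-comm : ∀ i j α β x → 2 ≤ ∣ i - j ∣ → Cell i x → Cell j x →
      γ α i (γ β j x) ≡ γ β j (γ α i x)
    ssγ : ∀ i α x → Cell i x → Cell (suc i) x →
      s (suc i) (s i (γ α (suc i) x)) ≡ γ α i (s (suc i) x)

-- The four identities are consequences of the two connection laws
-- γ⁺x ∘ᵢ₊₁ γ⁻x = x and γ⁺x ∘ᵢ γ⁻x = sᵢx, which pin down the faces of γ^∓x,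
-- together with the interchange law (for (ii)) and the invertibility of sⱼ
-- with inverse s̃ⱼ (for (iii) and (iv)).
module Submission where

open import Defs
open import Data.Nat using (zero; suc; _≤_; ∣_-_∣; s≤s)
open import Data.Nat.Properties using (∣-∣-comm)
open import Data.Product using (Σ; Σ-syntax; _×_; _,_; proj₁)
open import Relation.Binary.PropositionalEquality
  using (_≡_; _≢_; refl; sym; trans; cong; subst; subst₂; ≢-sym; module ≡-Reasoning)
open import Function.Bundles using (module Equivalence)

far⇒≢ : ∀ {i j} → 2 ≤ ∣ i - j ∣ → i ≢ j
far⇒≢ {zero}  () refl
far⇒≢ {suc i} h  refl = far⇒≢ {i} h refl

far⇒≢suc : ∀ {i j} → 2 ≤ ∣ i - j ∣ → i ≢ suc j
far⇒≢suc {j = zero}  (s≤s ()) refl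
far⇒≢suc {j = suc j} h        refl = far⇒≢suc {j = j} h refl

far-sym : ∀ i j → 2 ≤ ∣ i - j ∣ → 2 ≤ ∣ j - i ∣
far-sym i j = subst (2 ≤_) (∣-∣-comm i j)

module SingleSetCategory {S : Set} {δ⁻ δ⁺ : S → S} {Comp : S → S → S → Set}
                         (isCat : IsSingleSetCategory δ⁻ δ⁺ Comp) where
  open IsSingleSetCategory isCat public
  open Equivalence

  compose : ∀ {x y} → δ⁺ x ≡ δ⁻ y → Σ[ z ∈ S ] Comp x y z
  compose = from (defined _ _)

  comp⇒δ⁺≡δ⁻ : ∀ {x y z} → Comp x y z → δ⁺ x ≡ δ⁻ y
  comp⇒δ⁺≡δ⁻ c = to (defined _ _) (_ , c)

  δ⁻x∘x : ∀ x → Comp (δ⁻ x) x x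
  δ⁻x∘x x = from (unitˡ x x) refl

  x∘δ⁺x : ∀ x → Comp x (δ⁺ x) x
  x∘δ⁺x x = from (unitʳ x x) refl

  δ⁺∘δ⁻ : ∀ x → δ⁺ (δ⁻ x) ≡ δ⁻ x
  δ⁺∘δ⁻ x = comp⇒δ⁺≡δ⁻ (δ⁻x∘x x)

  δ⁻∘δ⁺ : ∀ x → δ⁻ (δ⁺ x) ≡ δ⁺ x
  δ⁻∘δ⁺ x = sym (comp⇒δ⁺≡δ⁻ (x∘δ⁺x x))

  -- Associativity rewrites the composite z of x and y as δ⁻x ∘ z (resp. z ∘ δ⁺y).
  δ⁻-comp : ∀ {x y z} → Comp x y z → δ⁻ z ≡ δ⁻ x
  δ⁻-comp {x} {y} {z} c with from (assoc (δ⁻ x) x y z) (x , δ⁻x∘x x , c)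
  ... | u , cu , δ⁻x∘u with functional x y u z cu c
  ... | refl = trans (sym (comp⇒δ⁺≡δ⁻ δ⁻x∘u)) (δ⁺∘δ⁻ x)

  δ⁺-comp : ∀ {x y z} → Comp x y z → δ⁺ z ≡ δ⁺ y
  δ⁺-comp {x} {y} {z} c with to (assoc x y (δ⁺ y) z) (y , x∘δ⁺x y , c)
  ... | v , cv , v∘δ⁺y with functional x y v z cv c
  ... | refl = trans (comp⇒δ⁺≡δ⁻ v∘δ⁺y) (δ⁻∘δ⁺ y)

  δ⁻∘δ⁻ : ∀ x → δ⁻ (δ⁻ x) ≡ δ⁻ x
  δ⁻∘δ⁻ x = sym (δ⁻-comp (δ⁻x∘x x))

  δ⁺-fixed : ∀ {x} → δ⁻ x ≡ x → δ⁺ x ≡ x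
  δ⁺-fixed {x} h = subst (λ w → δ⁺ w ≡ w) h (δ⁺∘δ⁻ x)

module _ (C : CubicalωCat) where
  open CubicalωCat C
  module Cat i = SingleSetCategory (isCat i)
  open Cat

  Cell-δ-same : ∀ α j x → Cell j (δ α j x)
  Cell-δ-same ⁻ j x = δ⁻∘δ⁻ j x
  Cell-δ-same ⁺ j x = δ⁻∘δ⁺ j x

  Cell-δ : ∀ {i j} α x → j ≢ i → Cell j x → Cell j (δ α i x)
  Cell-δ {i} {j} α x j≢i h = trans (δ-comm j i ⁻ α j≢i x) (cong (δ α i) h)

  Cell-γ : ∀ {i j} β x → i ≢ j → i ≢ suc j → Cell j x → Cell i x → Cell i (γ β j x)
  Cell-γ {i} {j} β x i≢j i≢sj hj hi =
    trans (γ-δ-other i j ⁻ β x i≢j i≢sj hj) (cong (γ β j) hi)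

  s̃-unique : ∀ {j u v} → Cell j v → s j v ≡ u → s̃ j u ≡ v
  s̃-unique {j} hv refl = s̃s j _ hv

  Cell-s̃ : ∀ {i j} y → i ≢ j → i ≢ suc j → Cell i y → Cell (suc j) y → Cell i (s̃ j y)
  Cell-s̃ {i} {j} y i≢j i≢sj hi hj = sym (s̃-unique (Cell-δ ⁻ u (≢-sym i≢j) hu) s-face)
    where
    u : S
    u = s̃ j y
    hu : Cell j u
    hu = s̃-cell j y hj
    s-face : s j (δ ⁻ i u) ≡ y
    s-face = begin
      s j (δ ⁻ i u)  ≡⟨ sym (δ-s-other i j ⁻ u i≢j i≢sj hu) ⟩
      δ ⁻ i (s j u)  ≡⟨ cong (δ ⁻ i) (ss̃ j y hj) ⟩
      δ ⁻ i y        ≡⟨ hi ⟩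
      y              ∎
      where open ≡-Reasoning

  -- δ^α_{j+1}x lies in S^{j,j+1}, where sⱼ is the identity.
  δ-s≡δ-suc : ∀ j α x → Cell j x → δ α j (s j x) ≡ δ α (suc j) x
  δ-s≡δ-suc j α x h =
    trans (δ-s-same j α x h)
          (s-id j _ (Cell-δ α x (λ ()) h) (Cell-δ-same α (suc j) x))

  γ∓-faces : ∀ j α x → Cell j x →
      (δ α j (γ (opp α) j x) ≡ δ α (suc j) x)
      × (δ α (suc j) (γ (opp α) j x) ≡ δ α (suc j) x)
  γ∓-faces j ⁻ x h =
    trans (sym (δ⁻-comp j (γ-inv₂ j x h))) (δ-s≡δ-suc j ⁻ x h)
    , sym (δ⁻-comp (suc j) (γ-inv₁ j x h))
  γ∓-faces j ⁺ x h =
    trans (sym (δ⁺-comp j (γ-inv₂ j x h))) (δ-s≡δ-suc j ⁺ x h)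
    , sym (δ⁺-comp (suc j) (γ-inv₁ j x h))

  -- Interchange, read backwards: a j-composite of two i-composites is also an
  -- i-composite of the j-composites of the rows, provided the rows compose.
  transpose-comp : ∀ {i j p q r t a′ b′ w} → i ≢ j →
      δ ⁺ i p ≡ δ ⁻ i q → δ ⁺ i r ≡ δ ⁻ i t →
      Comp j p r a′ → Comp j q t b′ → Comp i a′ b′ w →
      Σ[ a ∈ S ] Σ[ b ∈ S ] (Comp i p q a × Comp i r t b × Comp j a b w)
  transpose-comp {i} {j} i≢j pq rt p∘r q∘t a′∘b′
    with compose i pq | compose i rt
  ... | a , p∘q | b , r∘t
    with interchange i j i≢j _ _ _ _ _ _ _ _ p∘q r∘t p∘r q∘t
  ... | e , a∘b , a′∘b′↦e with functional i _ _ _ _ a′∘b′ a′∘b′↦e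
  ... | refl = a , b , p∘q , r∘t , a∘b

  γ⁺-comp-transposed : ∀ i x y z → Cell i x → Cell i y → Comp (suc i) x y z →
      Σ[ a ∈ S ] Σ[ b ∈ S ]
        (Comp i (γ ⁺ i x) x a × Comp i (s i x) (γ ⁺ i y) b
         × Comp (suc i) a b (γ ⁺ i z))
  γ⁺-comp-transposed i x y z hx hy x∘y with γ⁺-comp i x y z hx hy x∘y
  ... | _ , _ , p∘r , q∘t , a′∘b′ =
    transpose-comp (λ ()) (trans (γ-δ-same i ⁺ x hx) (sym hx)) s-x-meets-γ⁺y
      p∘r q∘t a′∘b′
    where
    open ≡-Reasoning
    s-x-meets-γ⁺y : δ ⁺ i (s i x) ≡ δ ⁻ i (γ ⁺ i y)
    s-x-meets-γ⁺y = begin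
      δ ⁺ i (s i x)      ≡⟨ δ-s≡δ-suc i ⁺ x hx ⟩
      δ ⁺ (suc i) x      ≡⟨ comp⇒δ⁺≡δ⁻ (suc i) x∘y ⟩
      δ ⁻ (suc i) y      ≡⟨ sym (proj₁ (γ∓-faces i ⁻ y hy)) ⟩
      δ ⁻ i (γ ⁺ i y)    ∎

  γ⁻-comp-transposed : ∀ i x y z → Cell i x → Cell i y → Comp (suc i) x y z →
      Σ[ a ∈ S ] Σ[ b ∈ S ]
        (Comp i (γ ⁻ i x) (s i y) a × Comp i y (γ ⁻ i y) b
         × Comp (suc i) a b (γ ⁻ i z))
  γ⁻-comp-transposed i x y z hx hy x∘y with γ⁻-comp i x y z hx hy x∘y
  ... | _ , _ , p∘r , q∘t , a′∘b′ =
    transpose-comp (λ ()) γ⁻x-meets-s-y (trans (δ⁺-fixed i hy) (sym (γ-δ-same i ⁻ y hy)))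
      p∘r q∘t a′∘b′
    where
    open ≡-Reasoning
    γ⁻x-meets-s-y : δ ⁺ i (γ ⁻ i x) ≡ δ ⁻ i (s i y)
    γ⁻x-meets-s-y = begin
      δ ⁺ i (γ ⁻ i x)    ≡⟨ proj₁ (γ∓-faces i ⁺ x hx) ⟩
      δ ⁺ (suc i) x      ≡⟨ comp⇒δ⁺≡δ⁻ (suc i) x∘y ⟩
      δ ⁻ (suc i) y      ≡⟨ sym (δ-s≡δ-suc i ⁻ y hy) ⟩
      δ ⁻ i (s i y)      ∎

  -- Apply γ^α_i to γ⁺ⱼx ∘ⱼ γ⁻ⱼx = sⱼx and commute γ^α_i past γ^±ⱼ.
  γ-s-comm : ∀ i j α → 2 ≤ ∣ i - j ∣ → ∀ x → Cell i x → Cell j x →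
      γ α i (s j x) ≡ s j (γ α i x)
  γ-s-comm i j α far x hi hj = functional j _ _ _ _ γᵢ[γ⁺x∘γ⁻x] (γ-inv₂ j (γ α i x) hγ)
    where
    i≢j : i ≢ j
    i≢j = far⇒≢ far
    i≢sj : i ≢ suc j
    i≢sj = far⇒≢suc far
    j≢i : j ≢ i
    j≢i = far⇒≢ (far-sym i j far)
    j≢si : j ≢ suc i
    j≢si = far⇒≢suc (far-sym i j far)
    hγ : Cell j (γ α i x)
    hγ = Cell-γ α x j≢i j≢si hi hj
    γᵢ[γ⁺x∘γ⁻x] : Comp j (γ ⁺ j (γ α i x)) (γ ⁻ j (γ α i x)) (γ α i (s j x))
    γᵢ[γ⁺x∘γ⁻x] =
      subst₂ (λ p q → Comp j p q (γ α i (s j x)))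
        (γ-comm i j α ⁺ x far hi hj) (γ-comm i j α ⁻ x far hi hj)
        (γ-comp-other i j α _ _ _ j≢i j≢si
          (Cell-γ ⁺ x i≢j i≢sj hj hi) (Cell-γ ⁻ x i≢j i≢sj hj hi) (γ-inv₂ j x hj))

  γ-s̃-comm : ∀ i j α → 2 ≤ ∣ i - j ∣ → ∀ y → Cell i y → Cell (suc j) y →
      γ α i (s̃ j y) ≡ s̃ j (γ α i y)
  γ-s̃-comm i j α far y hi hj = sym (s̃-unique hγ s[γu]≡γy)
    where
    u : S
    u = s̃ j y
    hu : Cell j u
    hu = s̃-cell j y hj
    hui : Cell i u
    hui = Cell-s̃ y (far⇒≢ far) (far⇒≢suc far) hi hj
    hγ : Cell j (γ α i u)
    hγ = Cell-γ α u (far⇒≢ (far-sym i j far)) (far⇒≢suc (far-sym i j far)) hui hu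
    s[γu]≡γy : s j (γ α i u) ≡ γ α i y
    s[γu]≡γy = trans (sym (γ-s-comm i j α far u hui hu)) (cong (γ α i) (ss̃ j y hj))

  s̃s̃γ : ∀ i α x → Cell i x → Cell (suc (suc i)) x →
      s̃ i (s̃ (suc i) (γ α i x)) ≡ γ α (suc i) (s̃ (suc i) x)
  s̃s̃γ i α x hi hj =
    trans (cong (s̃ i) (s̃-unique (s-cell i _ hg) ssg≡γx)) (s̃s i _ hg)
    where
    u : S
    u = s̃ (suc i) x
    hu : Cell (suc i) u
    hu = s̃-cell (suc i) x hj
    hui : Cell i u
    hui = Cell-s̃ x (λ ()) (λ ()) hi hj
    g : S
    g = γ α (suc i) u
    hg : Cell i g
    hg = Cell-γ α u (λ ()) (λ ()) hu hui
    ssg≡γx : s (suc i) (s i g) ≡ γ α i x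
    ssg≡γx = trans (ssγ i α u hui hu) (cong (γ α i) (ss̃ (suc i) x hj))

lemma2p3p4 : (C : CubicalωCat) → let open CubicalωCat C in
    (∀ j α x → Cell j x →
      (δ α j (γ (opp α) j x) ≡ δ α (suc j) x)
      × (δ α (suc j) (γ (opp α) j x) ≡ δ α (suc j) x))
    × (∀ i x y z → Cell i x → Cell i y → Comp (suc i) x y z →
      (Σ[ a ∈ S ] Σ[ b ∈ S ]
        (Comp i (γ ⁺ i x) x a × Comp i (s i x) (γ ⁺ i y) b
         × Comp (suc i) a b (γ ⁺ i z)))
      × (Σ[ a ∈ S ] Σ[ b ∈ S ]
        (Comp i (γ ⁻ i x) (s i y) a × Comp i y (γ ⁻ i y) b
         × Comp (suc i) a b (γ ⁻ i z))))
    × (∀ i j α → 2 ≤ ∣ i - j ∣ →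
      (∀ x → Cell i x → Cell j x → γ α i (s j x) ≡ s j (γ α i x))
      × (∀ y → Cell i y → Cell (suc j) y → γ α i (s̃ j y) ≡ s̃ j (γ α i y)))
    × (∀ i α x → Cell i x → Cell (suc (suc i)) x →
      s̃ i (s̃ (suc i) (γ α i x)) ≡ γ α (suc i) (s̃ (suc i) x))
lemma2p3p4 C =
    γ∓-faces C
  , (λ i x y z hx hy x∘y →
        γ⁺-comp-transposed C i x y z hx hy x∘y , γ⁻-comp-transposed C i x y z hx hy x∘y)
  , (λ i j α far → γ-s-comm C i j α far , γ-s̃-comm C i j α far)
  , s̃s̃γ C
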